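{- For every real $\alpha \ge 8$, every positive integer $k$ is forcing for $\mathcal{C}_{\overline{\alpha}}$.
   Context: A weighing of a graph $G$ is a function $w: E(G) \to \{ -1,1\}$; $w(H)=\sum_{e\in E(H)} w(e)$ for a subgraph $H$. $w$ is $k$-local positive if $w(H)>0$ for every connected subgraph $H$ of $G$ with exactly $k$ edges. For an infinite family $\mathcal{G}$ of connected graphs, $k$ is forcing for $\mathcal{G}$ if for all but finitely many $G\in\mathcal{G}$, every $k$-local positive weighing $w$ of $G$ satisfies $w(G)>0$. $\mathcal{C}_{\overline{\alpha}}$ is the family of all connected graphs with average degree at least $\alpha$.
   Formalization: The parameter α ranges over the rationals at least 8 instead of the reals. -}

module Defs where

open import Data.Nat as ℕ using (ℕ; zero; suc)
open import Data.Fin using (Fin; toℕ)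
open import Data.Bool using (Bool; true; false; if_then_else_)
open import Data.Integer as ℤ using (ℤ; +_)
open import Data.Rational as ℚ using (ℚ)
open import Data.Product using (Σ; ∃; _×_)
open import Data.Sum using (_⊎_)
open import Relation.Binary.PropositionalEquality using (_≡_)

∑ : ∀ {A : Set} → (A → A → A) → A → (n : ℕ) → (Fin n → A) → A
∑ _⊕_ e zero    f = e
∑ _⊕_ e (suc n) f = f Fin.zero ⊕ ∑ _⊕_ e n (λ i → f (Fin.suc i))
  where import Data.Fin as Fin

record Graph (n : ℕ) : Set where
  field
    adj        : Fin n → Fin n → Bool
    adj-sym    : ∀ i j → adj i j ≡ adj j i
    adj-irrefl : ∀ i → adj i i ≡ false
open Graph public

data Walk {n : ℕ} (R : Fin n → Fin n → Bool) : Fin n → Fin n → Set where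
  here : ∀ u → Walk R u u
  step : ∀ {u v w} → (R u v ≡ true ⊎ R v u ≡ true) → Walk R v w → Walk R u w

Connected : ∀ {n} → Graph n → Set
Connected {n} G = (0 ℕ.< n) × (∀ u v → Walk (adj G) u v)

-- The edges of G, each edge {i,j} listed once as the ordered pair i < j.
EdgeRel : ∀ {n} → Graph n → Fin n → Fin n → Bool
EdgeRel G i j = if adj G i j then (if toℕ i ℕ.<ᵇ toℕ j then true else false) else false

-- An edge set H (edge {i,j}, i<j, encoded as H i j ≡ true) of a subgraph of G.
-- The subgraph is the one formed by these edges and their endpoints.
SubEdges : ∀ {n} → Graph n → (Fin n → Fin n → Bool) → Set
SubEdges {n} G H = ∀ (i j : Fin n) → H i j ≡ true → (toℕ i ℕ.< toℕ j) × (adj G i j ≡ true)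

numEdges : ∀ {n} → (Fin n → Fin n → Bool) → ℕ
numEdges {n} H = ∑ ℕ._+_ 0 n (λ i → ∑ ℕ._+_ 0 n (λ j → if H i j then 1 else 0))

Incident : ∀ {n} → (Fin n → Fin n → Bool) → Fin n → Set
Incident H u = ∃ λ v → (H u v ≡ true ⊎ H v u ≡ true)

ConnectedSub : ∀ {n} → (Fin n → Fin n → Bool) → Set
ConnectedSub H = ∀ u v → Incident H u → Incident H v → Walk H u v

-- A weighing: values ±1 on the edges of G (values elsewhere are irrelevant).
record Weighing {n : ℕ} (G : Graph n) : Set where
  field
    w     : Fin n → Fin n → ℤ
    w-pm1 : ∀ i j → EdgeRel G i j ≡ true → (w i j ≡ ℤ.+ 1 ⊎ w i j ≡ ℤ.- (ℤ.+ 1))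
open Weighing public

weight : ∀ {n} {G : Graph n} → Weighing G → (Fin n → Fin n → Bool) → ℤ
weight {n} W H = ∑ ℤ._+_ (ℤ.+ 0) n (λ i → ∑ ℤ._+_ (ℤ.+ 0) n (λ j → if H i j then w W i j else ℤ.+ 0))

LocalPositive : ℕ → ∀ {n} (G : Graph n) → Weighing G → Set
LocalPositive k {n} G W =
  ∀ (H : Fin n → Fin n → Bool) → SubEdges G H → numEdges H ≡ k → ConnectedSub H →
  ℤ.+ 0 ℤ.< weight W H

Family : Set₁
Family = ∀ {n} → Graph n → Set

-- k is forcing for 𝒢: all but finitely many G ∈ 𝒢 (equivalently, up to isomorphism:
-- all G ∈ 𝒢 with at least N vertices, for some N) satisfy: every k-local positive
-- weighing w has w(G) > 0.
Forcing : ℕ → Family → Set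
Forcing k 𝒢 = ∃ λ (N : ℕ) → ∀ {n} (G : Graph n) → 𝒢 G → N ℕ.≤ n →
  ∀ (W : Weighing G) → LocalPositive k G W → ℤ.+ 0 ℤ.< weight W (EdgeRel G)

-- 𝒞_{ᾱ}: connected graphs with average degree 2|E|/|V| ≥ α, i.e. α·|V| ≤ 2|E|.
C-avg : ℚ → Family
C-avg α {n} G = Connected G × (α ℚ.* (ℤ.+ n ℚ./ 1) ℚ.≤ (ℤ.+ (2 ℕ.* numEdges (EdgeRel G)) ℚ./ 1))

-- If w(G) ≤ 0, then at least half of the ≥ 4|V| edges of G are negative.  Walk around a
-- spanning tree (at most 2|V| moves) and, for every negative edge the walk does not use, insert
-- a pending step that stays at an endpoint and only claims that edge.  Charge each step +1 if it
-- moves and −1 if its edge is negative: the total charge is ≤ 0, so by the cycle lemma some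
-- rotation of this closed walk has all its prefix charges ≤ 0.  The edges claimed by a prefix form
-- a connected subgraph of weight at most the prefix charge, and their number grows by at most one
-- per step up to at least 2|V| ≥ k; the prefix claiming exactly k edges contradicts k-local
-- positivity.
module Submission where

open import Defs

open import Algebra.Bundles using (CommutativeMonoid)
open import Data.Bool using (Bool; true; false; if_then_else_; _∨_; _∧_; not)
open import Data.Bool.Properties using (∨-zeroʳ)
open import Data.Empty using (⊥; ⊥-elim)
open import Data.Fin using (Fin; zero; suc; toℕ)
open import Data.Fin.Properties using (_≟_)
open import Data.Integer as ℤ using (ℤ; 0ℤ)
import Data.Integer.Properties as ℤ
open import Data.List using (List; []; _∷_; _++_; [_]; length; filterᵇ)
open import Data.List.Properties using (++-assoc; ++-identityʳ; ∷-injective; filter-++; length-++)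
open import Data.List.Relation.Binary.Permutation.Propositional using (_↭_; ↭-refl; ↭-sym)
open import Data.List.Relation.Binary.Permutation.Propositional.Properties
  using (↭-length; filter-↭)
open import Data.Nat using (ℕ; zero; suc)
import Data.Nat.Properties as ℕ
open import Data.Product using (Σ; ∃; ∃₂; _×_; _,_; proj₁; proj₂)
open import Data.Sum using (_⊎_; inj₁; inj₂)
import Data.Sum as Sum
open import Function using (_∘_; id)
open import Level using (0ℓ)
open import Relation.Binary.PropositionalEquality
  using (_≡_; refl; sym; trans; cong; cong₂; subst; subst₂; module ≡-Reasoning)
open import Relation.Nullary using (does; yes; no)
open import Relation.Nullary.Decidable using (T?; dec-true)

private
  variable
    n : ℕ

EdgeSet : ℕ → Set
EdgeSet n = Fin n → Fin n → Bool

∅ : EdgeSet n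
∅ _ _ = false

infixr 6 _∪_
infixr 7 _∩_
infix 4 _⊆_ _≐_

_∪_ _∩_ : EdgeSet n → EdgeSet n → EdgeSet n
(H ∪ K) i j = H i j ∨ K i j
(H ∩ K) i j = H i j ∧ K i j

⁅_,_⁆ : Fin n → Fin n → EdgeSet n
⁅ a , b ⁆ i j = does (i ≟ a) ∧ does (j ≟ b)

_⊆_ : EdgeSet n → EdgeSet n → Set
H ⊆ K = ∀ {i j} → H i j ≡ true → K i j ≡ true

_≐_ : EdgeSet n → EdgeSet n → Set
H ≐ K = ∀ i j → H i j ≡ K i j

∨-true⁻ : ∀ {x y} → x ∨ y ≡ true → x ≡ true ⊎ y ≡ true
∨-true⁻ {true} _ = inj₁ refl
∨-true⁻ {false} y≡true = inj₂ y≡true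

∨-false⁻ : ∀ {x y} → x ∨ y ≡ false → x ≡ false × y ≡ false
∨-false⁻ {false} y≡false = refl , y≡false

∧-true⁻ : ∀ {x y} → x ∧ y ≡ true → x ≡ true × y ≡ true
∧-true⁻ {true} {true} _ = refl , refl

∪-⊆ˡ : {H K : EdgeSet n} → H ⊆ H ∪ K
∪-⊆ˡ h rewrite h = refl

∪-⊆ʳ : {H K : EdgeSet n} → K ⊆ H ∪ K
∪-⊆ʳ {H = H} {i = i} {j} h rewrite h = ∨-zeroʳ (H i j)

⁅⁆-sound : ∀ (a b i j : Fin n) → ⁅ a , b ⁆ i j ≡ true → i ≡ a × j ≡ b
⁅⁆-sound a b i j h with i ≟ a | j ≟ b
... | yes i≡a | yes j≡b = i≡a , j≡b

⁅⁆-complete : ∀ (a b : Fin n) → ⁅ a , b ⁆ a b ≡ true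
⁅⁆-complete a b = cong₂ _∧_ (dec-true (a ≟ a) refl) (dec-true (b ≟ b) refl)

module FiniteSum (M : CommutativeMonoid 0ℓ 0ℓ) where
  open CommutativeMonoid M
    using (_≈_; setoid; _∙_; ε; reflexive; ∙-congʳ; ∙-congˡ; identityˡ; identityʳ)
    renaming (Carrier to A; refl to ≈-refl; sym to ≈-sym; trans to ≈-trans)
  open import Algebra.Properties.CommutativeMonoid.Sum M
    using (sum; sum-cong-≋; sum-replicate-zero; ∑-distrib-+)
  open import Relation.Binary.Reasoning.Setoid setoid

  -- ∑ᶠ unfolds to Defs' ∑, so n cannot be inferred through it and is often passed explicitly.
  ∑ᶠ : (Fin n → A) → A
  ∑ᶠ {n} = ∑ _∙_ ε n

  ∑ᶠ≡sum : (f : Fin n → A) → ∑ᶠ f ≡ sum f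
  ∑ᶠ≡sum {zero} f = refl
  ∑ᶠ≡sum {suc n} f = cong (f zero ∙_) (∑ᶠ≡sum (f ∘ suc))

  ∑ᶠ-cong : {f g : Fin n → A} → (∀ i → f i ≈ g i) → ∑ᶠ f ≈ ∑ᶠ g
  ∑ᶠ-cong {f = f} {g} f≈g = begin
    ∑ᶠ f  ≡⟨ ∑ᶠ≡sum f ⟩
    sum f ≈⟨ sum-cong-≋ f≈g ⟩
    sum g ≡⟨ ∑ᶠ≡sum g ⟨
    ∑ᶠ g  ∎

  ∑ᶠ-zero : ∀ n → ∑ᶠ {n} (λ _ → ε) ≈ ε
  ∑ᶠ-zero n = begin
    ∑ᶠ {n} (λ _ → ε) ≡⟨ ∑ᶠ≡sum {n} (λ _ → ε) ⟩
    sum {n} (λ _ → ε) ≈⟨ sum-replicate-zero n ⟩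
    ε                ∎

  ∑ᶠ-distrib : (f g : Fin n → A) → ∑ᶠ (λ i → f i ∙ g i) ≈ ∑ᶠ f ∙ ∑ᶠ g
  ∑ᶠ-distrib f g = begin
    ∑ᶠ (λ i → f i ∙ g i)  ≡⟨ ∑ᶠ≡sum (λ i → f i ∙ g i) ⟩
    sum (λ i → f i ∙ g i) ≈⟨ ∑-distrib-+ f g ⟩
    sum f ∙ sum g         ≡⟨ cong₂ _∙_ (∑ᶠ≡sum f) (∑ᶠ≡sum g) ⟨
    ∑ᶠ f ∙ ∑ᶠ g           ∎

  restrict : Bool → A → A
  restrict b x = if b then x else ε

  restrict-∧ : ∀ b c x → restrict (b ∧ c) x ≡ restrict b (restrict c x)
  restrict-∧ true  c x = refl
  restrict-∧ false c x = refl

  restrict-∨ : ∀ d b x → restrict (d ∨ b) x ≈ restrict d (restrict (not b) x) ∙ restrict b x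
  restrict-∨ true  true  x = ≈-sym (identityˡ x)
  restrict-∨ true  false x = ≈-sym (identityʳ x)
  restrict-∨ false b     x = ≈-sym (identityˡ (restrict b x))

  ∑ᶠ-restrict : ∀ b (f : Fin n → A) → ∑ᶠ (λ i → restrict b (f i)) ≈ restrict b (∑ᶠ f)
  ∑ᶠ-restrict true  f = ≈-refl
  ∑ᶠ-restrict {n} false f = ∑ᶠ-zero n

  ∑ᶠ-restrict-≟ : (a : Fin n) (f : Fin n → A) → ∑ᶠ (λ i → restrict (does (i ≟ a)) (f i)) ≈ f a
  ∑ᶠ-restrict-≟ {suc n} zero    f = ≈-trans (∙-congˡ (∑ᶠ-zero n)) (identityʳ (f zero))
  ∑ᶠ-restrict-≟ {suc n} (suc a) f = ≈-trans (identityˡ _) (∑ᶠ-restrict-≟ a (f ∘ suc))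

  ∑∑ : (Fin n → Fin n → A) → A
  ∑∑ f = ∑ᶠ (λ i → ∑ᶠ (f i))

  ∑∑-cong : {f g : Fin n → Fin n → A} → (∀ i j → f i j ≈ g i j) → ∑∑ f ≈ ∑∑ g
  ∑∑-cong {n} f≈g = ∑ᶠ-cong {n} (λ i → ∑ᶠ-cong {n} (f≈g i))

  ∑∑-distrib : (f g : Fin n → Fin n → A) → ∑∑ (λ i j → f i j ∙ g i j) ≈ ∑∑ f ∙ ∑∑ g
  ∑∑-distrib {n} f g = ≈-trans (∑ᶠ-cong {n} (λ i → ∑ᶠ-distrib (f i) (g i))) (∑ᶠ-distrib {n} _ _)

  mass : (Fin n → Fin n → A) → EdgeSet n → A
  mass f H = ∑∑ (λ i j → restrict (H i j) (f i j))

  mass-cong : ∀ f {H K : EdgeSet n} → H ≐ K → mass f H ≈ mass f K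
  mass-cong {n} f H≐K = ∑∑-cong {n} (λ i j → reflexive (cong (λ b → restrict b (f i j)) (H≐K i j)))

  mass-∅ : (f : Fin n → Fin n → A) → mass f ∅ ≈ ε
  mass-∅ {n} f = ≈-trans (∑ᶠ-cong {n} (λ _ → ∑ᶠ-zero n)) (∑ᶠ-zero n)

  mass-⁅⁆ : ∀ f (a b : Fin n) → mass f ⁅ a , b ⁆ ≈ f a b
  mass-⁅⁆ {n} f a b = begin
    mass f ⁅ a , b ⁆
      ≈⟨ ∑∑-cong {n} (λ i j → reflexive (restrict-∧ (does (i ≟ a)) (does (j ≟ b)) (f i j))) ⟩
    ∑ᶠ (λ i → ∑ᶠ (λ j → restrict (does (i ≟ a)) (restrict (does (j ≟ b)) (f i j))))
      ≈⟨ ∑ᶠ-cong {n} (λ i → ∑ᶠ-restrict {n} (does (i ≟ a)) _) ⟩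
    ∑ᶠ (λ i → restrict (does (i ≟ a)) (∑ᶠ (λ j → restrict (does (j ≟ b)) (f i j))))
      ≈⟨ ∑ᶠ-restrict-≟ a _ ⟩
    ∑ᶠ (λ j → restrict (does (j ≟ b)) (f a j))
      ≈⟨ ∑ᶠ-restrict-≟ b _ ⟩
    f a b ∎

  mass-insert : ∀ f (a b : Fin n) H →
                mass f (⁅ a , b ⁆ ∪ H) ≈ restrict (not (H a b)) (f a b) ∙ mass f H
  mass-insert {n} f a b H = begin
    mass f (⁅ a , b ⁆ ∪ H)
      ≈⟨ ∑∑-cong {n} (λ i j → restrict-∨ (⁅ a , b ⁆ i j) (H i j) (f i j)) ⟩
    ∑∑ (λ i j → restrict (⁅ a , b ⁆ i j) (restrict (not (H i j)) (f i j)) ∙ restrict (H i j) (f i j))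
      ≈⟨ ∑∑-distrib {n} _ _ ⟩
    mass (λ i j → restrict (not (H i j)) (f i j)) ⁅ a , b ⁆ ∙ mass f H
      ≈⟨ ∙-congʳ (mass-⁅⁆ _ a b) ⟩
    restrict (not (H a b)) (f a b) ∙ mass f H ∎

-- numEdges H and weight W H are, definitionally, ℕΣ.mass (λ _ _ → 1) H and ℤΣ.mass (w W) H.
module ℕΣ = FiniteSum ℕ.+-0-commutativeMonoid
module ℤΣ = FiniteSum ℤ.+-0-commutativeMonoid

++-≡-++ : {A : Set} (xs ys us vs : List A) → xs ++ ys ≡ us ++ vs →
          (∃ λ zs → xs ≡ us ++ zs) ⊎ (∃ λ zs → us ≡ xs ++ zs × ys ≡ zs ++ vs)
++-≡-++ []       ys us       vs eq = inj₂ (us , refl , eq)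
++-≡-++ (x ∷ xs) ys []       vs _  = inj₁ (x ∷ xs , refl)
++-≡-++ (x ∷ xs) ys (u ∷ us) vs eq with ∷-injective eq
... | refl , eq′ with ++-≡-++ xs ys us vs eq′
...   | inj₁ (zs , refl)      = inj₁ (zs , refl)
...   | inj₂ (zs , refl , eq″) = inj₂ (zs , refl , eq″)

module Counting where
  open import Data.Nat using (_+_; _≤_; z≤n; s≤s)
  open import Data.Nat.Properties
    using (≤-refl; ≤-trans; ≤-antisym; ≤∧≢⇒<; +-mono-≤; +-monoˡ-≤; module ≤-Reasoning)

  indicator : Bool → ℕ
  indicator b = if b then 1 else 0

  count : {A : Set} → (A → Bool) → List A → ℕ
  count p = length ∘ filterᵇ p

  count-∷ : {A : Set} (p : A → Bool) (x : A) (xs : List A) → count p (x ∷ xs) ≡ indicator (p x) + count p xs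
  count-∷ p x xs with p x
  ... | true  = refl
  ... | false = refl

  count-++ : {A : Set} (p : A → Bool) (xs ys : List A) → count p (xs ++ ys) ≡ count p xs + count p ys
  count-++ p xs ys = trans (cong length (filter-++ (T? ∘ p) xs ys)) (length-++ (filterᵇ p xs))

  count-↭ : {A : Set} (p : A → Bool) {xs ys : List A} → xs ↭ ys → count p xs ≡ count p ys
  count-↭ p = ↭-length ∘ filter-↭ (T? ∘ p)

  numEdges-∅ : numEdges (∅ {n}) ≡ 0
  numEdges-∅ {n} = ℕΣ.mass-∅ {n} (λ _ _ → 1)

  numEdges-cong : {H K : EdgeSet n} → H ≐ K → numEdges H ≡ numEdges K
  numEdges-cong {n} = ℕΣ.mass-cong {n} (λ _ _ → 1)

  ∑-mono : {f g : Fin n → ℕ} → (∀ i → f i ≤ g i) → ∑ _+_ 0 n f ≤ ∑ _+_ 0 n g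
  ∑-mono {zero}  _   = z≤n
  ∑-mono {suc n} f≤g = +-mono-≤ (f≤g zero) (∑-mono (f≤g ∘ suc))

  indicator-mono : ∀ {b c} → (b ≡ true → c ≡ true) → indicator b ≤ indicator c
  indicator-mono {false} _   = z≤n
  indicator-mono {true}  b⇒c rewrite b⇒c refl = ≤-refl

  indicator≤1 : ∀ b → indicator b ≤ 1
  indicator≤1 false = z≤n
  indicator≤1 true  = ≤-refl

  numEdges-mono : (H K : EdgeSet n) → H ⊆ K → numEdges H ≤ numEdges K
  numEdges-mono {n} H K H⊆K = ∑-mono {n} (λ i → ∑-mono {n} (λ j → indicator-mono (H⊆K {i} {j})))

  numEdges-insert : ∀ (a b : Fin n) H → numEdges (⁅ a , b ⁆ ∪ H) ≤ suc (numEdges H)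
  numEdges-insert {n} a b H = begin
    numEdges (⁅ a , b ⁆ ∪ H)             ≡⟨ ℕΣ.mass-insert {n} (λ _ _ → 1) a b H ⟩
    indicator (not (H a b)) + numEdges H ≤⟨ +-monoˡ-≤ (numEdges H) (indicator≤1 (not (H a b))) ⟩
    suc (numEdges H)                     ∎
    where open ≤-Reasoning

  prefix-with-value : {X : Set} (f : List X → ℕ) → (∀ P x → f (P ++ [ x ]) ≤ suc (f P)) →
                      ∀ L {k} → f [] ≤ k → k ≤ f L → ∃₂ λ P Q → L ≡ P ++ Q × f P ≡ k
  prefix-with-value {X} f f-snoc L {k} = search [] L
    where
    search : ∀ P R → f P ≤ k → k ≤ f (P ++ R) → ∃₂ λ P′ Q → P ++ R ≡ P′ ++ Q × f P′ ≡ k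
    search P R fP≤k k≤fPR with f P ℕ.≟ k
    search P R       _    _     | yes fP≡k = P , R , refl , fP≡k
    search P []      fP≤k k≤fP  | no fP≢k =
      ⊥-elim (fP≢k (≤-antisym fP≤k (subst (λ Q → k ≤ f Q) (++-identityʳ P) k≤fP)))
    search P (x ∷ R) fP≤k k≤fPR | no fP≢k
      with search (P ++ [ x ]) R (≤-trans (f-snoc P x) (≤∧≢⇒< fP≤k fP≢k))
                  (subst (λ Q → k ≤ f Q) (sym (++-assoc P [ x ] R)) k≤fPR)
    ... | P′ , Q , eq , fP′≡k = P′ , Q , trans (sym (++-assoc P [ x ] R)) eq , fP′≡k

module CycleLemma {X : Set} (σ : X → ℤ) where
  open import Data.Integer using (_+_; _≤_; -_)
  open import Data.Integer.Properties
    using (≤-refl; ≤-trans; ≤-total; +-monoʳ-≤; +-identityˡ; +-identityʳ; +-assoc; +-comm; +-0-abelianGroup)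
  open import Algebra.Properties.AbelianGroup +-0-abelianGroup using (\\-leftDividesʳ)

  total : List X → ℤ
  total []       = 0ℤ
  total (x ∷ xs) = σ x + total xs

  total-++ : ∀ xs ys → total (xs ++ ys) ≡ total xs + total ys
  total-++ []       ys = sym (+-identityˡ (total ys))
  total-++ (x ∷ xs) ys = trans (cong (σ x +_) (total-++ xs ys)) (sym (+-assoc (σ x) (total xs) (total ys)))

  +-cancelˡ-≤ : ∀ a {i j} → a + i ≤ a + j → i ≤ j
  +-cancelˡ-≤ a {i} {j} a+i≤a+j =
    subst₂ _≤_ (\\-leftDividesʳ a i) (\\-leftDividesʳ a j) (+-monoʳ-≤ (- a) a+i≤a+j)

  prefix-∷ : ∀ {x : X} {L} P Q → x ∷ L ≡ P ++ Q → P ≡ [] ⊎ ∃ λ P′ → P ≡ x ∷ P′ × L ≡ P′ ++ Q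
  prefix-∷ []       Q _  = inj₁ refl
  prefix-∷ (_ ∷ P′) Q eq with ∷-injective eq
  ... | refl , L≡ = inj₂ (P′ , refl , L≡)

  MaximalPrefix : List X → List X → Set
  MaximalPrefix L A = ∀ P Q → L ≡ P ++ Q → total P ≤ total A

  maximal-prefix : ∀ L → ∃₂ λ A B → L ≡ A ++ B × MaximalPrefix L A
  maximal-prefix [] = [] , [] , refl , λ where
    [] _ _ → ≤-refl
    (_ ∷ _) _ ()
  maximal-prefix (x ∷ L) with maximal-prefix L
  ... | A , B , refl , max with ≤-total (σ x + total A) 0ℤ
  ...   | inj₁ x+A≤0 = [] , x ∷ A ++ B , refl , bound
    where
    bound : MaximalPrefix (x ∷ A ++ B) []
    bound P Q eq with prefix-∷ P Q eq
    ... | inj₁ refl               = ≤-refl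
    ... | inj₂ (P′ , refl , eq′) = ≤-trans (+-monoʳ-≤ (σ x) (max P′ Q eq′)) x+A≤0
  ...   | inj₂ 0≤x+A = x ∷ A , B , refl , bound
    where
    bound : MaximalPrefix (x ∷ A ++ B) (x ∷ A)
    bound P Q eq with prefix-∷ P Q eq
    ... | inj₁ refl               = 0≤x+A
    ... | inj₂ (P′ , refl , eq′) = +-monoʳ-≤ (σ x) (max P′ Q eq′)

  -- Cut after a prefix of maximal total.
  rotation-with-nonpositive-prefixes :
    ∀ L → total L ≤ 0ℤ → ∃₂ λ A B → L ≡ A ++ B × (∀ P Q → B ++ A ≡ P ++ Q → total P ≤ 0ℤ)
  rotation-with-nonpositive-prefixes L L≤0 with maximal-prefix L
  ... | A , B , refl , max = A , B , refl , bound
    where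
    bound : ∀ P Q → B ++ A ≡ P ++ Q → total P ≤ 0ℤ
    bound P Q eq with ++-≡-++ B A P Q eq
    ... | inj₁ (C , refl) = +-cancelˡ-≤ (total A) (begin
      total A + total P ≡⟨ total-++ A P ⟨
      total (A ++ P)    ≤⟨ max (A ++ P) C (sym (++-assoc A P C)) ⟩
      total A           ≡⟨ +-identityʳ (total A) ⟨
      total A + 0ℤ      ∎)
      where open Data.Integer.Properties.≤-Reasoning
    ... | inj₂ (D , refl , refl) = begin
      total (B ++ D)    ≡⟨ total-++ B D ⟩
      total B + total D ≤⟨ +-monoʳ-≤ (total B) (max D (Q ++ B) (++-assoc D Q B)) ⟩
      total B + total A ≡⟨ +-comm (total B) (total A) ⟩
      total A + total B ≡⟨ total-++ A B ⟨
      total (A ++ B)    ≤⟨ L≤0 ⟩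
      0ℤ                ∎
      where open Data.Integer.Properties.≤-Reasoning

infixr 5 _◅◅_

_◅◅_ : ∀ {R : EdgeSet n} {x y z} → Walk R x y → Walk R y z → Walk R x z
here _   ◅◅ q = q
step e p ◅◅ q = step e (p ◅◅ q)

walk-reverse : ∀ {R : EdgeSet n} {x y} → Walk R x y → Walk R y x
walk-reverse (here x)   = here x
walk-reverse (step e p) = walk-reverse p ◅◅ step (Sum.swap e) (here _)

walk-map : ∀ {R S : EdgeSet n} → R ⊆ S → ∀ {x y} → Walk R x y → Walk S x y
walk-map R⊆S (here x)   = here x
walk-map R⊆S (step e p) = step (Sum.map R⊆S R⊆S e) (walk-map R⊆S p)

incident-∪ : ∀ {H K : EdgeSet n} {u} → Incident (H ∪ K) u → Incident H u ⊎ Incident K u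
incident-∪ (v , inj₁ h) = Sum.map (λ h → v , inj₁ h) (λ h → v , inj₁ h) (∨-true⁻ h)
incident-∪ (v , inj₂ h) = Sum.map (λ h → v , inj₂ h) (λ h → v , inj₂ h) (∨-true⁻ h)

module Tours {n : ℕ} (G : Graph n) where
  open import Data.Nat using (_+_; _*_; _≤_; _<_; _<ᵇ_; z≤n; s≤s)
  open import Data.Nat.Properties
    using (≤-refl; ≤-trans; ≤-reflexive; m≤n+m; *-suc; *-monoʳ-≤; +-monoʳ-≤; <⇒<ᵇ; <ᵇ⇒<)
  open import Data.Bool.Properties using (T-≡; ∨-commutativeMonoid)
  open import Algebra.Properties.CommutativeSemigroup
    (CommutativeMonoid.commutativeSemigroup ∨-commutativeMonoid) using (x∙yz≈y∙xz)
  open import Data.Fin using (fromℕ<)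
  open import Data.Fin.Properties using (<-cmp; all?; ¬∀⟶∃¬)
  open import Data.Fin.Subset using (Subset; ∣_∣; _⊂_; _⊃_)
    renaming (⁅_⁆ to ⁅_⁆ᵛ; _∈_ to _∈ᵛ_; _∉_ to _∉ᵛ_; _∪_ to _∪ᵛ_)
  open import Data.Fin.Subset.Properties
    using (_∈?_; x∈⁅x⁆; x∈⁅y⁆⇒x≡y; p⊆p∪q; x∈p∪q⁻; x∈p∪q⁺; p⊂q⇒∣p∣<∣q∣)
  open import Data.Fin.Subset.Induction using (⊃-wellFounded; Acc; acc)
  open import Data.List.Membership.Propositional using (_∈_; find)
  open import Data.List.Membership.Propositional.Properties using (∈-∃++)
  open import Data.List.Relation.Unary.All using (All; []; _∷_)
  open import Data.List.Relation.Unary.Any using (Any; here; there)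
  import Data.List.Relation.Unary.Any.Properties as Any
  import Data.List.Relation.Binary.Permutation.Propositional as Perm
  open import Data.List.Relation.Binary.Permutation.Propositional.Properties
    using (++-comm; ++⁺ˡ; Any-resp-↭; All-resp-↭)
  open import Function using (Equivalence)
  open import Relation.Binary.Definitions using (tri<; tri≈; tri>)
  open Counting

  E : EdgeSet n
  E = EdgeRel G

  private
    variable
      i j u v x y z : Fin n

  edgeRel-intro : adj G i j ≡ true → toℕ i < toℕ j → E i j ≡ true
  edgeRel-intro {i} {j} i─j i<j rewrite i─j | Equivalence.to T-≡ (<⇒<ᵇ i<j) = refl

  edgeRel-elim : E i j ≡ true → toℕ i < toℕ j × adj G i j ≡ true
  edgeRel-elim {i} {j} e with adj G i j | toℕ i <ᵇ toℕ j in i<ᵇj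
  edgeRel-elim {i} {j} e  | true | true = <ᵇ⇒< (toℕ i) (toℕ j) (Equivalence.from T-≡ i<ᵇj) , refl
  edgeRel-elim         () | true | false
  edgeRel-elim         () | false | _

  record Edge : Set where
    constructor edge
    field
      lo hi  : Fin n
      isEdge : E lo hi ≡ true
  open Edge

  _∋_ : EdgeSet n → Edge → Bool
  H ∋ e = H (lo e) (hi e)

  ⟦_⟧ : Edge → EdgeSet n
  ⟦ e ⟧ = ⁅ lo e , hi e ⁆

  Endpoint : Edge → Fin n → Set
  Endpoint e x = x ≡ lo e ⊎ x ≡ hi e

  orient : adj G u v ≡ true → Σ Edge λ e → Endpoint e u × Endpoint e v
  orient {u} {v} u─v with <-cmp u v
  ... | tri< u<v _ _ = edge u v (edgeRel-intro u─v u<v) , inj₁ refl , inj₂ refl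
  ... | tri≈ _ refl _ with () ← trans (sym u─v) (adj-irrefl G u)
  ... | tri> _ _ v<u = edge v u (edgeRel-intro (trans (adj-sym G v u) u─v) v<u) , inj₂ refl , inj₁ refl

  endpoint-walk : ∀ e → Endpoint e x → Endpoint e y → Walk ⟦ e ⟧ x y
  endpoint-walk e (inj₁ refl) (inj₁ refl) = here _
  endpoint-walk e (inj₁ refl) (inj₂ refl) = step (inj₁ (⁅⁆-complete (lo e) (hi e))) (here _)
  endpoint-walk e (inj₂ refl) (inj₁ refl) = step (inj₂ (⁅⁆-complete (lo e) (hi e))) (here _)
  endpoint-walk e (inj₂ refl) (inj₂ refl) = here _

  incident-⟦⟧ : ∀ e → Incident ⟦ e ⟧ u → Endpoint e u
  incident-⟦⟧ {u} e (v , inj₁ h) = inj₁ (proj₁ (⁅⁆-sound (lo e) (hi e) u v h))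
  incident-⟦⟧ {u} e (v , inj₂ h) = inj₂ (proj₂ (⁅⁆-sound (lo e) (hi e) v u h))

  -- A pending step (moving = false) does not move: it only claims its edge.
  record Step : Set where
    field
      along    : Edge
      from to  : Fin n
      from-end : Endpoint along from
      to-end   : Endpoint along to
      moving   : Bool
  open Step

  pending : Edge → Step
  pending e = record
    { along = e ; from = lo e ; to = lo e ; from-end = inj₁ refl ; to-end = inj₁ refl ; moving = false }

  data Chain : Fin n → List Step → Fin n → Set where
    []  : Chain x [] x
    _∷_ : ∀ {L} (s : Step) → Chain (to s) L z → Chain (from s) (s ∷ L) z

  chain-++ : ∀ {A B} → Chain x A y → Chain y B z → Chain x (A ++ B) z
  chain-++ []      c′ = c′
  chain-++ (s ∷ c) c′ = s ∷ chain-++ c c′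

  chain-split : ∀ A {B} → Chain x (A ++ B) z → ∃ λ y → Chain x A y × Chain y B z
  chain-split []      c        = _ , [] , c
  chain-split (s ∷ A) (.s ∷ c) with chain-split A c
  ... | y , cA , cB = y , s ∷ cA , cB

  chain-rotate : ∀ A {B} → Chain x (A ++ B) x → ∃ λ y → Chain y (B ++ A) y
  chain-rotate A c with chain-split A c
  ... | y , cA , cB = y , chain-++ cB cA

  edges : List Step → EdgeSet n
  edges []      = ∅
  edges (s ∷ L) = ⟦ along s ⟧ ∪ edges L

  edges-∷ˡ : ∀ s L → ⟦ along s ⟧ ⊆ edges (s ∷ L)
  edges-∷ˡ s L = ∪-⊆ˡ {H = ⟦ along s ⟧} {edges L}

  edges-∷ʳ : ∀ s L → edges L ⊆ edges (s ∷ L)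
  edges-∷ʳ s L = ∪-⊆ʳ {H = ⟦ along s ⟧} {edges L}

  edges⊆E : ∀ L → edges L ⊆ E
  edges⊆E (s ∷ L) {i} {j} h with ∨-true⁻ h
  ... | inj₂ h-L = edges⊆E L h-L
  ... | inj₁ h-s with ⁅⁆-sound (lo (along s)) (hi (along s)) i j h-s
  ...   | refl , refl = isEdge (along s)

  edges-sub : ∀ L → SubEdges G (edges L)
  edges-sub L _ _ = edgeRel-elim ∘ edges⊆E L

  edges-snoc : ∀ P s → edges (P ++ [ s ]) ≐ ⟦ along s ⟧ ∪ edges P
  edges-snoc []      s i j = refl
  edges-snoc (t ∷ P) s i j =
    trans (cong (⟦ along t ⟧ i j ∨_) (edges-snoc P s i j))
          (x∙yz≈y∙xz (⟦ along t ⟧ i j) (⟦ along s ⟧ i j) (edges P i j))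

  edges-↭ : ∀ {L L′} → L ↭ L′ → edges L ≐ edges L′
  edges-↭ Perm.refl          i j = refl
  edges-↭ (Perm.prep s p)    i j = cong (⟦ along s ⟧ i j ∨_) (edges-↭ p i j)
  edges-↭ (Perm.swap s t p)  i j =
    trans (x∙yz≈y∙xz (⟦ along s ⟧ i j) (⟦ along t ⟧ i j) _)
          (cong (λ b → ⟦ along t ⟧ i j ∨ (⟦ along s ⟧ i j ∨ b)) (edges-↭ p i j))
  edges-↭ (Perm.trans p q)   i j = trans (edges-↭ p i j) (edges-↭ q i j)

  ∈⇒edges : ∀ {s L} → s ∈ L → edges L ∋ along s ≡ true
  ∈⇒edges {s} (here refl) rewrite ⁅⁆-complete (lo (along s)) (hi (along s)) = refl
  ∈⇒edges {L = t ∷ L} (there s∈L) = edges-∷ʳ t L (∈⇒edges s∈L)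

  fresh⇒not-along : ∀ {s L} e → s ∈ L → edges L ∋ e ≡ false → ⟦ e ⟧ ∋ along s ≡ false
  fresh⇒not-along {s} {L} e s∈L L∌e with ⟦ e ⟧ ∋ along s in hit
  ... | false = refl
  ... | true with ⁅⁆-sound (lo e) (hi e) (lo (along s)) (hi (along s)) hit
  ...   | lo≡ , hi≡ with () ← trans (sym L∌e) (subst₂ (λ a b → edges L a b ≡ true) lo≡ hi≡ (∈⇒edges s∈L))

  multiplicity : List Step → Edge → ℕ
  multiplicity L e = count (λ s → ⟦ along s ⟧ ∋ e) L

  ∉edges⇒multiplicity≡0 : ∀ L e → edges L ∋ e ≡ false → multiplicity L e ≡ 0
  ∉edges⇒multiplicity≡0 []      _ _ = refl
  ∉edges⇒multiplicity≡0 (s ∷ L) e h with ∨-false⁻ {⟦ along s ⟧ ∋ e} h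
  ... | s∌e , L∌e = trans (count-∷ (λ t → ⟦ along t ⟧ ∋ e) s L)
                          (cong₂ _+_ (cong indicator s∌e) (∉edges⇒multiplicity≡0 L e L∌e))

  edges⇒multiplicity : ∀ L e → edges L ∋ e ≡ true → 1 ≤ multiplicity L e
  edges⇒multiplicity (s ∷ L) e h =
    ≤-trans (either (∨-true⁻ {⟦ along s ⟧ ∋ e} h)) (≤-reflexive (sym (count-∷ (λ t → ⟦ along t ⟧ ∋ e) s L)))
    where
    either : ⟦ along s ⟧ ∋ e ≡ true ⊎ edges L ∋ e ≡ true → 1 ≤ indicator (⟦ along s ⟧ ∋ e) + multiplicity L e
    either (inj₁ s∋e) rewrite s∋e = s≤s z≤n
    either (inj₂ L∋e) = ≤-trans (edges⇒multiplicity L e L∋e) (m≤n+m _ _)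

  multiplicity-∷-self : ∀ s L → multiplicity (s ∷ L) (along s) ≡ suc (multiplicity L (along s))
  multiplicity-∷-self s L =
    trans (count-∷ (λ t → ⟦ along t ⟧ ∋ along s) s L)
          (cong (λ b → indicator b + multiplicity L (along s)) (⁅⁆-complete (lo (along s)) (hi (along s))))

  single⇒fresh : ∀ s L → multiplicity (s ∷ L) (along s) ≤ 1 → edges L ∋ along s ≡ false
  single⇒fresh s L once with edges L ∋ along s in L∋s
  ... | false = refl
  ... | true with s≤s () ← ≤-trans (s≤s (edges⇒multiplicity L (along s) L∋s))
                                   (≤-trans (≤-reflexive (sym (multiplicity-∷-self s L))) once)

  chain-reaches-start : ∀ {L} → Chain x L z → Incident (edges L) u → Walk (edges L) u x
  chain-reaches-start []      (_ , inj₁ ())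
  chain-reaches-start []      (_ , inj₂ ())
  chain-reaches-start {L = s ∷ L} (.s ∷ c) u∈ with incident-∪ {H = ⟦ along s ⟧} {edges L} u∈
  ... | inj₁ u∈s = walk-map (edges-∷ˡ s L) (endpoint-walk (along s) (incident-⟦⟧ (along s) u∈s) (from-end s))
  ... | inj₂ u∈L = walk-map (edges-∷ʳ s L) (chain-reaches-start c u∈L)
                ◅◅ walk-map (edges-∷ˡ s L) (endpoint-walk (along s) (to-end s) (from-end s))

  chain-connected : ∀ {L} → Chain x L z → ConnectedSub (edges L)
  chain-connected c u v u∈ v∈ = chain-reaches-start c u∈ ◅◅ walk-reverse (chain-reaches-start c v∈)

  record Tour : Set where
    field
      root   : Fin n
      steps  : List Step
      closed : Chain root steps root
  open Tour

  Visits : Tour → Fin n → Set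
  Visits T u = u ≡ root T ⊎ Any (λ s → from s ≡ u) (steps T)

  rotate-to : ∀ {ρ L} → Chain ρ L ρ → Any (λ s → from s ≡ u) L → ∃ λ L′ → L′ ↭ L × Chain u L′ u
  rotate-to c u∈ with find u∈
  ... | s , s∈L , refl with ∈-∃++ s∈L
  ...   | A , B , refl with chain-split A c
  ...     | _ , cA , (.s ∷ cB) = s ∷ B ++ A , ++-comm (s ∷ B) A , chain-++ (s ∷ cB) cA

  root-visited : ∀ {ρ L} → Chain ρ L ρ → u ≡ ρ ⊎ Any (λ s → from s ≡ u) L → ρ ≡ u ⊎ Any (λ s → from s ≡ ρ) L
  root-visited []      (inj₁ refl) = inj₁ refl
  root-visited (s ∷ _) _           = inj₂ (here refl)

  rotate-visited : (T : Tour) → Visits T u → ∃ λ L′ → L′ ↭ steps T × Chain u L′ u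
  rotate-visited T (inj₁ refl) = steps T , ↭-refl , closed T
  rotate-visited T (inj₂ u∈L)  = rotate-to (closed T) u∈L

  record Splice (T : Tour) (S : List Step) : Set where
    field
      result        : Tour
      result-↭      : steps result ↭ S ++ steps T
      result-visits : ∀ {v} → Visits T v → Visits result v

  splice : ∀ {S} (T : Tour) → Visits T u → Chain u S u → Splice T S
  splice {u} {S} T u∈T cS = record { result = T′ ; result-↭ = T′↭ ; result-visits = keeps }
    where
    rotated : ∃ λ L′ → L′ ↭ steps T × Chain u L′ u
    rotated = rotate-visited T u∈T

    T′ : Tour
    T′ = record { root = u ; steps = S ++ proj₁ rotated ; closed = chain-++ cS (proj₂ (proj₂ rotated)) }

    T′↭ : steps T′ ↭ S ++ steps T
    T′↭ = ++⁺ˡ S (proj₁ (proj₂ rotated))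

    moved : ∀ {v} → Any (λ s → from s ≡ v) (steps T) → Any (λ s → from s ≡ v) (steps T′)
    moved = Any-resp-↭ (↭-sym T′↭) ∘ Any.++⁺ʳ S

    keeps : ∀ {v} → Visits T v → Visits T′ v
    keeps (inj₂ v∈L)  = inj₂ (moved v∈L)
    keeps (inj₁ refl) with root-visited (closed T) u∈T
    ... | inj₁ root≡u = inj₁ root≡u
    ... | inj₂ root∈L = inj₂ (moved root∈L)

  record TreeTour (R : Subset n) : Set where
    field
      tour       : Tour
      visits     : ∀ {u} → u ∈ᵛ R → Visits tour u
      moves      : count moving (steps tour) ≤ 2 * ∣ R ∣
      all-moving : All (λ s → moving s ≡ true) (steps tour)
  open TreeTour

  ⊂-∪⁅⁆ : ∀ {R} → v ∉ᵛ R → R ⊂ R ∪ᵛ ⁅ v ⁆ᵛ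
  ⊂-∪⁅⁆ {v} v∉R = p⊆p∪q ⁅ v ⁆ᵛ , v , x∈p∪q⁺ (inj₂ (x∈⁅x⁆ v)) , v∉R

  extend : ∀ {R} → TreeTour R → u ∈ᵛ R → v ∉ᵛ R → adj G u v ≡ true → TreeTour (R ∪ᵛ ⁅ v ⁆ᵛ)
  extend {u} {v} {R} t u∈R v∉R u─v with orient u─v
  ... | e , u∈e , v∈e = record
    { tour       = result
    ; visits     = visits′
    ; moves      = moves′
    ; all-moving = All-resp-↭ (↭-sym result-↭) (refl ∷ refl ∷ all-moving t)
    }
    where
    out back : Step
    out  = record { along = e ; from = u ; to = v ; from-end = u∈e ; to-end = v∈e ; moving = true }
    back = record { along = e ; from = v ; to = u ; from-end = v∈e ; to-end = u∈e ; moving = true }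

    spliced : Splice (tour t) (out ∷ back ∷ [])
    spliced = splice (tour t) (visits t u∈R) (out ∷ back ∷ [])
    open Splice spliced

    visits′ : ∀ {x} → x ∈ᵛ R ∪ᵛ ⁅ v ⁆ᵛ → Visits result x
    visits′ x∈ with x∈p∪q⁻ R ⁅ v ⁆ᵛ x∈
    ... | inj₁ x∈R = result-visits (visits t x∈R)
    ... | inj₂ x∈v rewrite x∈⁅y⁆⇒x≡y v x∈v = inj₂ (Any-resp-↭ (↭-sym result-↭) (there (here refl)))

    moves′ : count moving (steps result) ≤ 2 * ∣ R ∪ᵛ ⁅ v ⁆ᵛ ∣
    moves′ = begin
      count moving (steps result)                  ≡⟨ count-↭ moving result-↭ ⟩
      2 + count moving (steps (tour t))            ≤⟨ +-monoʳ-≤ 2 (moves t) ⟩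
      2 + 2 * ∣ R ∣                                ≡⟨ *-suc 2 ∣ R ∣ ⟨
      2 * suc ∣ R ∣                                ≤⟨ *-monoʳ-≤ 2 (p⊂q⇒∣p∣<∣q∣ (⊂-∪⁅⁆ v∉R)) ⟩
      2 * ∣ R ∪ᵛ ⁅ v ⁆ᵛ ∣                          ∎
      where open Data.Nat.Properties.≤-Reasoning

  crossing-edge : ∀ {R} → Walk (adj G) x z → x ∈ᵛ R → z ∉ᵛ R →
                  ∃₂ λ u v → u ∈ᵛ R × v ∉ᵛ R × adj G u v ≡ true
  crossing-edge (here _) x∈R x∉R = ⊥-elim (x∉R x∈R)
  crossing-edge {R = R} (step {u = x} {v = y} x─y p) x∈R z∉R with y ∈? R
  ... | yes y∈R = crossing-edge p y∈R z∉R
  ... | no  y∉R = x , y , x∈R , y∉R , Sum.[ id , trans (adj-sym G x y) ] x─y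

  spanning-tour : Connected G → ∃ λ R → TreeTour R × (∀ v → v ∈ᵛ R)
  spanning-tour (0<n , walk) = grow ⁅ r ⁆ᵛ (⊃-wellFounded _) (x∈⁅x⁆ r) single
    where
    r : Fin n
    r = fromℕ< 0<n

    single : TreeTour ⁅ r ⁆ᵛ
    single = record
      { tour       = record { root = r ; steps = [] ; closed = [] }
      ; visits     = λ u∈ → inj₁ (x∈⁅y⁆⇒x≡y r u∈)
      ; moves      = z≤n
      ; all-moving = []
      }

    grow : ∀ R → Acc _⊃_ R → r ∈ᵛ R → TreeTour R → ∃ λ R′ → TreeTour R′ × (∀ v → v ∈ᵛ R′)
    grow R (acc larger) r∈R t with all? (_∈? R)
    ... | yes all∈R = R , t , all∈R
    ... | no ¬all∈R with ¬∀⟶∃¬ n (_∈ᵛ R) (_∈? R) ¬all∈R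
    ...   | v , v∉R with crossing-edge (walk r v) r∈R v∉R
    ...     | x , y , x∈R , y∉R , x─y =
      grow (R ∪ᵛ ⁅ y ⁆ᵛ) (larger (⊂-∪⁅⁆ y∉R)) (p⊆p∪q ⁅ y ⁆ᵛ r∈R) (extend t x∈R y∉R x─y)

module Weighted {n : ℕ} {G : Graph n} (W : Weighing G) where
  open import Data.Nat using (_+_; _*_; _≤_; z≤n; s≤s)
  open import Data.Nat.Properties
    using (≤-trans; ≤-reflexive; m≤m+n; m≤n+m; m≤n*m; *-monoʳ-≤; *-cancelˡ-≤; *-assoc; +-identityʳ)
  open import Data.Integer using (+_; -1ℤ; +≤+; -≤+)
  open import Data.Integer.Tactic.RingSolver using (solve-∀)
  open import Data.Bool.Properties using (∧-zeroʳ)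
  open import Data.Fin.Subset using () renaming (_∈_ to _∈ᵛ_)
  open import Data.Fin.Subset.Properties using (∣p∣≤n)
  open import Data.List using (cartesianProduct; allFin)
  open import Data.List.Membership.Propositional using (_∈_)
  open import Data.List.Membership.Propositional.Properties
    using (∈-++⁺ˡ; ∈-++⁺ʳ; ∈-allFin; ∈-cartesianProduct⁺)
  import Data.List.Relation.Unary.All as All
  open import Data.List.Relation.Unary.Any using (here; there)
  open import Data.List.Relation.Binary.Permutation.Propositional.Properties using (++-comm; ∈-resp-↭)
  open Counting
  open Tours G
  open Edge
  open Step
  open Tour
  open TreeTour

  negative : EdgeSet n
  negative i j = does (w W i j ℤ.≟ -1ℤ)

  E⁻ : EdgeSet n
  E⁻ = E ∩ negative

  isNegative : Step → Bool
  isNegative s = negative ∋ along s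

  weightOf : Edge → ℤ
  weightOf e = w W (lo e) (hi e)

  weight≤1 : ∀ e → weightOf e ℤ.≤ + 1
  weight≤1 e with w-pm1 W (lo e) (hi e) (isEdge e)
  ... | inj₁ w≡1  rewrite w≡1  = ℤ.≤-refl
  ... | inj₂ w≡-1 rewrite w≡-1 = -≤+

  negative⇒-1 : ∀ i j → negative i j ≡ true → w W i j ≡ -1ℤ
  negative⇒-1 i j h with w W i j ℤ.≟ -1ℤ
  ... | yes w≡-1 = w≡-1

  -- The charge −1 of a pending step is the weight it adds only if its edge is new when claimed;
  -- in every rotation and prefix this is guaranteed by the edge occurring once in the walk.
  PendingSound : List Step → Set
  PendingSound L = ∀ {s} → s ∈ L → moving s ≡ false → isNegative s ≡ true × multiplicity L (along s) ≤ 1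

  pending-sound-mono : ∀ {L L′} → (∀ {s} → s ∈ L′ → s ∈ L) → (∀ p → count p L′ ≤ count p L) →
                       PendingSound L → PendingSound L′
  pending-sound-mono L′⊆L fewer sound s∈L′ pending with sound (L′⊆L s∈L′) pending
  ... | negative-s , once = negative-s , ≤-trans (fewer _) once

  pending-sound-++ˡ : ∀ A {B} → PendingSound (A ++ B) → PendingSound A
  pending-sound-++ˡ A {B} =
    pending-sound-mono ∈-++⁺ˡ (λ p → ≤-trans (m≤m+n _ _) (≤-reflexive (sym (count-++ p A B))))

  pending-sound-++ʳ : ∀ A {B} → PendingSound (A ++ B) → PendingSound B
  pending-sound-++ʳ A {B} =
    pending-sound-mono (∈-++⁺ʳ A) (λ p → ≤-trans (m≤n+m _ _) (≤-reflexive (sym (count-++ p A B))))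

  pending-sound-↭ : ∀ {L L′} → L ↭ L′ → PendingSound L → PendingSound L′
  pending-sound-↭ L↭L′ =
    pending-sound-mono (∈-resp-↭ (↭-sym L↭L′)) (λ p → ≤-reflexive (count-↭ p (↭-sym L↭L′)))

  charge : Step → ℤ
  charge s = + indicator (moving s) ℤ.- + indicator (isNegative s)

  open CycleLemma charge using (total; rotation-with-nonpositive-prefixes)

  total≡moves-negatives : ∀ L → total L ≡ + count moving L ℤ.- + count isNegative L
  total≡moves-negatives []      = refl
  total≡moves-negatives (s ∷ L) = begin
    charge s ℤ.+ total L
      ≡⟨ cong (λ t → charge s ℤ.+ t) (total≡moves-negatives L) ⟩
    (+ m ℤ.- + g) ℤ.+ (+ count moving L ℤ.- + count isNegative L)
      ≡⟨ regroup (+ m) (+ g) (+ count moving L) (+ count isNegative L) ⟩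
    (+ m ℤ.+ + count moving L) ℤ.- (+ g ℤ.+ + count isNegative L)
      ≡⟨ cong₂ ℤ._-_ (ℤ.pos-+ m (count moving L)) (ℤ.pos-+ g (count isNegative L)) ⟨
    + (m + count moving L) ℤ.- + (g + count isNegative L)
      ≡⟨ cong₂ (λ a b → + a ℤ.- + b) (count-∷ moving s L) (count-∷ isNegative s L) ⟨
    + count moving (s ∷ L) ℤ.- + count isNegative (s ∷ L) ∎
    where
    open ≡-Reasoning
    m g : ℕ
    m = indicator (moving s)
    g = indicator (isNegative s)
    regroup : ∀ a b c d → (a ℤ.- b) ℤ.+ (c ℤ.- d) ≡ (a ℤ.+ c) ℤ.- (b ℤ.+ d)
    regroup = solve-∀

  total≤0 : ∀ {L} → count moving L ≤ count isNegative L → total L ℤ.≤ 0ℤ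
  total≤0 {L} moves≤negatives =
    subst (ℤ._≤ 0ℤ) (sym (total≡moves-negatives L)) (ℤ.i≤j⇒i-j≤0 (+≤+ moves≤negatives))

  gain≤charge : ∀ m g c {x} → x ℤ.≤ + 1 → (g ≡ true → x ≡ -1ℤ) → (m ≡ false → g ≡ true × c ≡ false) →
                ℤΣ.restrict (not c) x ℤ.≤ + indicator m ℤ.- + indicator g
  gain≤charge true  true  true  _   _    _ = ℤ.≤-refl
  gain≤charge true  true  false _   x≡-1 _ rewrite x≡-1 refl = -≤+
  gain≤charge true  false true  _   _    _ = +≤+ z≤n
  gain≤charge true  false false x≤1 _    _ = x≤1
  gain≤charge false g     c     _   x≡-1 pending with pending refl
  ... | refl , refl rewrite x≡-1 refl = ℤ.≤-refl

  weight≤total : ∀ L → PendingSound L → weight W (edges L) ℤ.≤ total L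
  weight≤total []      _     = ℤ.≤-reflexive (ℤΣ.mass-∅ {n} (w W))
  weight≤total (s ∷ L) sound = begin
    weight W (edges (s ∷ L))
      ≡⟨ ℤΣ.mass-insert {n} (w W) (lo (along s)) (hi (along s)) (edges L) ⟩
    ℤΣ.restrict (not (edges L ∋ along s)) (weightOf (along s)) ℤ.+ weight W (edges L)
      ≤⟨ ℤ.+-mono-≤ (gain≤charge (moving s) (isNegative s) (edges L ∋ along s)
                                 (weight≤1 (along s)) (negative⇒-1 _ _) fresh)
                    (weight≤total L (pending-sound-++ʳ [ s ] sound)) ⟩
    charge s ℤ.+ total L ∎
    where
    open ℤ.≤-Reasoning
    fresh : moving s ≡ false → isNegative s ≡ true × edges L ∋ along s ≡ false
    fresh pending with sound (here refl) pending
    ... | negative-s , once = negative-s , single⇒fresh s L once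

  record Circuit : Set where
    field
      tour       : Tour
      visits-all : ∀ u → Visits tour u
      moves      : count moving (steps tour) ≤ 2 * n
      sound      : PendingSound (steps tour)
  open Circuit

  covered : Circuit → EdgeSet n
  covered C = edges (steps (tour C))

  tree-circuit : ∀ {R} → TreeTour R → (∀ v → v ∈ᵛ R) → Circuit
  tree-circuit {R} t all∈R = record
    { tour       = TreeTour.tour t
    ; visits-all = λ u → visits t (all∈R u)
    ; moves      = ≤-trans (TreeTour.moves t) (*-monoʳ-≤ 2 (∣p∣≤n R))
    ; sound      = no-pending
    }
    where
    no-pending : PendingSound (steps (TreeTour.tour t))
    no-pending s∈ pending with () ← trans (sym (All.lookup (all-moving t) s∈)) pending

  pending-sound-∷ : ∀ {e L} → negative ∋ e ≡ true → edges L ∋ e ≡ false →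
                    PendingSound L → PendingSound (pending e ∷ L)
  pending-sound-∷ {e} {L} negative-e L∌e _ (here refl) _ =
    negative-e ,
    ≤-reflexive (trans (multiplicity-∷-self (pending e) L) (cong suc (∉edges⇒multiplicity≡0 L e L∌e)))
  pending-sound-∷ {e} {L} _ L∌e sound {s} (there s∈L) pending-s with sound s∈L pending-s
  ... | negative-s , once = negative-s , ≤-trans (≤-reflexive unchanged) once
    where
    unchanged : multiplicity (pending e ∷ L) (along s) ≡ multiplicity L (along s)
    unchanged = trans (count-∷ (λ t → ⟦ along t ⟧ ∋ along s) (pending e) L)
                      (cong (λ b → indicator b + multiplicity L (along s)) (fresh⇒not-along e s∈L L∌e))

  claim : (C : Circuit) → ∀ i j →
          Σ Circuit λ C′ → covered C ⊆ covered C′ × (E⁻ i j ≡ true → covered C′ i j ≡ true)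
  claim C i j with E⁻ i j in i─j | covered C i j in covered-ij
  ... | false | _     = C , id , λ ()
  ... | true  | true  = C , id , λ _ → covered-ij
  ... | true  | false = C′ , grows , λ _ → claimed
    where
    e : Edge
    e = edge i j (proj₁ (∧-true⁻ i─j))

    spliced : Splice (tour C) (pending e ∷ [])
    spliced = splice (tour C) (visits-all C i) (pending e ∷ [])
    open Splice spliced

    C′ : Circuit
    C′ = record
      { tour       = result
      ; visits-all = λ u → result-visits (visits-all C u)
      ; moves      = ≤-trans (≤-reflexive (count-↭ moving result-↭)) (moves C)
      ; sound      = pending-sound-↭ (↭-sym result-↭)
                                     (pending-sound-∷ (proj₂ (∧-true⁻ i─j)) covered-ij (sound C))
      }

    grows : covered C ⊆ covered C′
    grows h = trans (edges-↭ result-↭ _ _) (edges-∷ʳ (pending e) (steps (tour C)) h)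

    claimed : covered C′ i j ≡ true
    claimed = trans (edges-↭ result-↭ i j) (edges-∷ˡ (pending e) (steps (tour C)) (⁅⁆-complete i j))

  claim-all : (ps : List (Fin n × Fin n)) (C : Circuit) →
              Σ Circuit λ C′ → covered C ⊆ covered C′ ×
                               (∀ {i j} → (i , j) ∈ ps → E⁻ i j ≡ true → covered C′ i j ≡ true)
  claim-all []             C = C , id , λ ()
  claim-all ((i , j) ∷ ps) C with claim C i j
  ... | C₁ , C⊆C₁ , claimed with claim-all ps C₁
  ...   | C₂ , C₁⊆C₂ , claimed-all = C₂ , C₁⊆C₂ ∘ C⊆C₁ , λ where
          (here refl) neg → C₁⊆C₂ (claimed neg)
          (there ij∈ps)   → claimed-all ij∈ps

  covering-circuit : Connected G → Σ Circuit λ C → E⁻ ⊆ covered C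
  covering-circuit connected =
    let R , t , all∈R  = spanning-tour connected
        C , _ , covers = claim-all (cartesianProduct (allFin n) (allFin n)) (tree-circuit t all∈R)
    in  C , λ {i} {j} → covers (∈-cartesianProduct⁺ (∈-allFin i) (∈-allFin j))

  ∩-edges-∷ : ∀ K s L → K ∩ edges (s ∷ L) ⊆ ⟦ along s ⟧ ∪ (K ∩ edges L)
  ∩-edges-∷ K s L {i} {j} h with ∧-true⁻ {K i j} h
  ... | K∋ij , ij∈ with ∨-true⁻ {⟦ along s ⟧ i j} ij∈
  ...   | inj₁ ij∈s = ∪-⊆ˡ {H = ⟦ along s ⟧} {K ∩ edges L} ij∈s
  ...   | inj₂ ij∈L rewrite K∋ij | ij∈L = ∨-zeroʳ (⟦ along s ⟧ i j)

  ∩-edges-∷-∌ : ∀ K s L → K ∋ along s ≡ false → K ∩ edges (s ∷ L) ⊆ K ∩ edges L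
  ∩-edges-∷-∌ K s L K∌s {i} {j} h with ∧-true⁻ {K i j} h
  ... | K∋ij , ij∈ with ∨-true⁻ {⟦ along s ⟧ i j} ij∈
  ...   | inj₂ ij∈L rewrite K∋ij | ij∈L = refl
  ...   | inj₁ ij∈s with ⁅⁆-sound (lo (along s)) (hi (along s)) i j ij∈s
  ...     | refl , refl with () ← trans (sym K∌s) K∋ij

  numEdges-∩-edges : ∀ K L → numEdges (K ∩ edges L) ≤ count (λ s → K ∋ along s) L
  numEdges-∩-edges K []      = ≤-reflexive (trans (numEdges-cong (λ i j → ∧-zeroʳ (K i j))) (numEdges-∅ {n}))
  numEdges-∩-edges K (s ∷ L) =
    ≤-trans (by-cases (K ∋ along s) refl) (≤-reflexive (sym (count-∷ (λ t → K ∋ along t) s L)))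
    where
    by-cases : ∀ b → K ∋ along s ≡ b → numEdges (K ∩ edges (s ∷ L)) ≤ indicator b + count (λ t → K ∋ along t) L
    by-cases true  _   = ≤-trans (numEdges-mono _ (⟦ along s ⟧ ∪ (K ∩ edges L)) (∩-edges-∷ K s L))
                         (≤-trans (numEdges-insert _ _ (K ∩ edges L)) (s≤s (numEdges-∩-edges K L)))
    by-cases false K∌s = ≤-trans (numEdges-mono _ (K ∩ edges L) (∩-edges-∷-∌ K s L K∌s)) (numEdges-∩-edges K L)

  negatives≤count : ∀ L → E⁻ ⊆ edges L → numEdges E⁻ ≤ count isNegative L
  negatives≤count L E⁻⊆L = ≤-trans (numEdges-mono E⁻ (negative ∩ edges L) into) (numEdges-∩-edges negative L)
    where
    into : E⁻ ⊆ negative ∩ edges L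
    into {i} {j} h rewrite proj₂ (∧-true⁻ {E i j} h) = E⁻⊆L h

  pos-∑ : ∀ {m} (f : Fin m → ℕ) → + ∑ _+_ 0 m f ≡ ∑ ℤ._+_ 0ℤ m (+_ ∘ f)
  pos-∑ {zero}  f = refl
  pos-∑ {suc m} f = trans (ℤ.pos-+ (f zero) _) (cong (λ t → + f zero ℤ.+ t) (pos-∑ (f ∘ suc)))

  pos-numEdges : ∀ H → + numEdges H ≡ ℤΣ.mass (λ _ _ → + 1) H
  pos-numEdges H =
    trans (pos-∑ {n} _) (ℤΣ.∑ᶠ-cong {n} λ i → trans (pos-∑ {n} _) (ℤΣ.∑ᶠ-cong {n} λ j → pos-indicator (H i j)))
    where
    pos-indicator : ∀ b → + indicator b ≡ ℤΣ.restrict b (+ 1)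
    pos-indicator true  = refl
    pos-indicator false = refl

  edges-by-sign : ∀ i j → ℤΣ.restrict (E i j) (+ 1) ≡
                  ℤΣ.restrict (E i j) (w W i j) ℤ.+ (ℤΣ.restrict (E⁻ i j) (+ 1) ℤ.+ ℤΣ.restrict (E⁻ i j) (+ 1))
  edges-by-sign i j with E i j in i─j
  ... | false = refl
  ... | true with w-pm1 W i j i─j
  ...   | inj₁ w≡1  rewrite w≡1  = refl
  ...   | inj₂ w≡-1 rewrite w≡-1 = refl

  edge-count-split : + numEdges E ≡ weight W E ℤ.+ (+ numEdges E⁻ ℤ.+ + numEdges E⁻)
  edge-count-split = begin
    + numEdges E
      ≡⟨ pos-numEdges E ⟩
    ℤΣ.mass (λ _ _ → + 1) E
      ≡⟨ ℤΣ.∑∑-cong {n} edges-by-sign ⟩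
    ℤΣ.∑∑ (λ i j → ℤΣ.restrict (E i j) (w W i j) ℤ.+ (ℤΣ.restrict (E⁻ i j) (+ 1) ℤ.+ ℤΣ.restrict (E⁻ i j) (+ 1)))
      ≡⟨ ℤΣ.∑∑-distrib {n} _ _ ⟩
    weight W E ℤ.+ ℤΣ.∑∑ (λ i j → ℤΣ.restrict (E⁻ i j) (+ 1) ℤ.+ ℤΣ.restrict (E⁻ i j) (+ 1))
      ≡⟨ cong (λ t → weight W E ℤ.+ t) (ℤΣ.∑∑-distrib {n} _ _) ⟩
    weight W E ℤ.+ (ℤΣ.mass (λ _ _ → + 1) E⁻ ℤ.+ ℤΣ.mass (λ _ _ → + 1) E⁻)
      ≡⟨ cong (λ t → weight W E ℤ.+ (t ℤ.+ t)) (pos-numEdges E⁻) ⟨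
    weight W E ℤ.+ (+ numEdges E⁻ ℤ.+ + numEdges E⁻) ∎
    where open ≡-Reasoning

  edges≤twice-negatives : weight W E ℤ.≤ 0ℤ → numEdges E ≤ numEdges E⁻ + numEdges E⁻
  edges≤twice-negatives light = ℤ.drop‿+≤+ (begin
    + numEdges E                                     ≡⟨ edge-count-split ⟩
    weight W E ℤ.+ (+ numEdges E⁻ ℤ.+ + numEdges E⁻) ≤⟨ ℤ.+-monoˡ-≤ _ light ⟩
    0ℤ ℤ.+ (+ numEdges E⁻ ℤ.+ + numEdges E⁻)         ≡⟨ ℤ.+-identityˡ _ ⟩
    + numEdges E⁻ ℤ.+ + numEdges E⁻                  ≡⟨ ℤ.pos-+ (numEdges E⁻) (numEdges E⁻) ⟨
    + (numEdges E⁻ + numEdges E⁻)                    ∎)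
    where open ℤ.≤-Reasoning

  many-negatives : 4 * n ≤ numEdges E → weight W E ℤ.≤ 0ℤ → 2 * n ≤ numEdges E⁻
  many-negatives dense light = *-cancelˡ-≤ 2 (begin
    2 * (2 * n)               ≡⟨ *-assoc 2 2 n ⟨
    4 * n                     ≤⟨ dense ⟩
    numEdges E                ≤⟨ edges≤twice-negatives light ⟩
    numEdges E⁻ + numEdges E⁻ ≡⟨ cong (λ t → numEdges E⁻ + t) (+-identityʳ (numEdges E⁻)) ⟨
    2 * numEdges E⁻           ∎)
    where open Data.Nat.Properties.≤-Reasoning

  numEdges-snoc : ∀ P s → numEdges (edges (P ++ [ s ])) ≤ suc (numEdges (edges P))
  numEdges-snoc P s = ≤-trans (≤-reflexive (numEdges-cong (edges-snoc P s))) (numEdges-insert _ _ (edges P))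

  no-light-window : ∀ {k y z L} → LocalPositive k G W → Chain y L z → PendingSound L →
                    (∀ P Q → L ≡ P ++ Q → total P ℤ.≤ 0ℤ) → k ≤ numEdges (edges L) → ⊥
  no-light-window {k} {L = L} positive c sound light k≤L
    with prefix-with-value (numEdges ∘ edges) numEdges-snoc L (subst (_≤ k) (sym (numEdges-∅ {n})) z≤n) k≤L
  ... | P , Q , refl , |P|≡k with chain-split P c
  ...   | _ , cP , _ = ℤ.<⇒≱ (positive (edges P) (edges-sub P) |P|≡k (chain-connected cP))
                             (ℤ.≤-trans (weight≤total P (pending-sound-++ˡ P sound)) (light P Q refl))

  light-rotation : ∀ {ρ L} → Chain ρ L ρ → total L ℤ.≤ 0ℤ →
                   ∃₂ λ y L′ → Chain y L′ y × L′ ↭ L × (∀ P Q → L′ ≡ P ++ Q → total P ℤ.≤ 0ℤ)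
  light-rotation {L = L} c L≤0 with rotation-with-nonpositive-prefixes L L≤0
  ... | A , B , refl , light with chain-rotate A c
  ...   | y , cBA = y , B ++ A , cBA , ++-comm B A , light

  moves≤negatives : (C : Circuit) → E⁻ ⊆ covered C → 2 * n ≤ numEdges E⁻ →
                    count moving (steps (tour C)) ≤ count isNegative (steps (tour C))
  moves≤negatives C covers many = ≤-trans (moves C) (≤-trans many (negatives≤count (steps (tour C)) covers))

  not-light : ∀ {k} → LocalPositive k G W → Connected G → k ≤ n → 2 * n ≤ numEdges E⁻ → ⊥
  not-light {k} positive connected k≤n many with covering-circuit connected
  ... | C , covers with light-rotation (closed (tour C)) (total≤0 {steps (tour C)} (moves≤negatives C covers many))
  ...   | _ , L′ , cL′ , L′↭L , light =
    no-light-window positive cL′ (pending-sound-↭ (↭-sym L′↭L) (sound C)) light k≤L′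
    where
    k≤L′ : k ≤ numEdges (edges L′)
    k≤L′ = ≤-trans k≤n (≤-trans (m≤n*m n 2) (≤-trans many
             (numEdges-mono E⁻ (edges L′) (λ h → trans (edges-↭ L′↭L _ _) (covers h)))))

  positive-weight : ∀ {k} → Connected G → 4 * n ≤ numEdges E → k ≤ n → LocalPositive k G W →
                    + 0 ℤ.< weight W E
  positive-weight connected dense k≤n positive with + 0 ℤ.<? weight W E
  ... | yes positive-total = positive-total
  ... | no  ¬positive      = ⊥-elim (not-light positive connected k≤n (many-negatives dense (ℤ.≮⇒≥ ¬positive)))

module AverageDegree where
  open import Data.Nat using (_*_; _≤_)
  open import Data.Nat.Properties using (*-cancelˡ-≤; *-assoc)
  open import Data.Nat.Coprimality using (1-coprimeTo) renaming (sym to coprime-sym)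
  open import Data.Integer using (+_)
  open import Data.Rational as ℚ using (ℚ; mkℚ; _/_)
  import Data.Rational.Properties as ℚ

  /1≡mkℚ : ∀ a → + a / 1 ≡ mkℚ (+ a) 0 (coprime-sym (1-coprimeTo a))
  /1≡mkℚ a = ℚ.normalize-coprime (coprime-sym (1-coprimeTo a))

  /1-* : ∀ a b → (+ a / 1) ℚ.* (+ b / 1) ≡ + (a * b) / 1
  /1-* a b rewrite /1≡mkℚ a | /1≡mkℚ b = cong (λ z → z / 1) (sym (ℤ.pos-* a b))

  /1-cancel-≤ : ∀ {a b} → + a / 1 ℚ.≤ + b / 1 → a ≤ b
  /1-cancel-≤ {a} {b} a≤b rewrite /1≡mkℚ a | /1≡mkℚ b =
    ℤ.drop‿+≤+ (subst₂ ℤ._≤_ (ℤ.*-identityʳ (+ a)) (ℤ.*-identityʳ (+ b)) (ℚ.drop-*≤* a≤b))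

  average-degree≥8⇒4n≤m : ∀ {α n m} → + 8 / 1 ℚ.≤ α → α ℚ.* (+ n / 1) ℚ.≤ + (2 * m) / 1 → 4 * n ≤ m
  average-degree≥8⇒4n≤m {α} {n} {m} 8≤α αn≤2m =
    *-cancelˡ-≤ 2 (subst (_≤ 2 * m) (*-assoc 2 4 n) (/1-cancel-≤ 8n≤2m))
    where
    8n≤2m : + (8 * n) / 1 ℚ.≤ + (2 * m) / 1
    8n≤2m = subst (ℚ._≤ + (2 * m) / 1) (/1-* 8 n)
                  (ℚ.≤-trans (ℚ.*-monoʳ-≤-nonNeg (+ n / 1) {{ℚ.normalize-nonNeg n 1}} 8≤α) αn≤2m)

-- Opened only now: ℚ's _≤_ would clash with ℕ's, which the modules above open locally.
open import Data.Nat using (ℕ; _<_)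
open import Data.Integer using (+_)
open import Data.Rational using (ℚ; _≤_; _/_)

lemma5p2 : ∀ (α : ℚ) → (+ 8 / 1) ≤ α → ∀ (k : ℕ) → 0 < k → Forcing k (C-avg α)
lemma5p2 α 8≤α k _ = k , λ {n} G (connected , dense) k≤n W →
  let 4n≤m = average-degree≥8⇒4n≤m {α} {n} {numEdges (EdgeRel G)} 8≤α dense
  in  Weighted.positive-weight W connected 4n≤m k≤n
  where open AverageDegree using (average-degree≥8⇒4n≤m)
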